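{- Let $\mathcal{C}$ be a homomorphism-closed class of successor $\tau$-structures, and let $r$ be the maximum arity of the symbols in $\tau$. If $\mathcal{C}$ can be defined by a read-once family of monotone nondeterministic branching programs of size $O(n^j)$, then every critical and split-minimal element of $\mathcal{C}$ has a $(j,r+j)$-path decomposition.
   Context: A successor $\tau$-structure has domain $\{1,\dots,n\}$ and, besides $\tau$, built-in relations $\mathfrak{first}=\{1\}$, $\mathfrak{last}=\{n\}$, $\mathfrak{suc}=\{(i,i+1)\}$; homomorphism-closure, substructures, split operations, criticality, split-minimality and path decompositions refer only to the $\tau$-relations. $\mathcal{C}$ is homomorphism-closed if $\mathbf{A}\in\mathcal{C}$, $\mathbf{A}\to\mathbf{B}$ imply $\mathbf{B}\in\mathcal{C}$. Split operation on $\mathbf{A}$: for $a\in A$ with $T_a=\{(\mathbf{t},R,i):\mathbf{t}\in R^{\mathbf{A}},R\in\tau,t_i=a\}$ of size $\ge2$, choose a nonempty proper subset $T$, add a new element $a'$, and replace the $i$-th entry of $\mathbf{t}$ by $a'$ for each $(\mathbf{t},R,i)\in T$. An element of $\mathcal{C}$ is split-minimal if no nonempty sequence of split operations yields an element of $\mathcal{C}$, and critical if no proper substructure lies in $\mathcal{C}$. A monotone nondeterministic branching program $H$ over variables $X$ is a directed graph with nodes $s,t$ whose arcs are either unlabeled or labeled by variables; for an assignment $\sigma:X\to\{0,1\}$, $H_\sigma$ keeps unlabeled arcs and arcs whose label is set to 1; $H$ accepts $\sigma$ iff $H_\sigma$ has a directed $s$–$t$ path (accepting path). Size $=|V(H)|$.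 For input size $n$, let $(R_1,\mathbf{t}_1),\dots,(R_q,\mathbf{t}_q)$ enumerate all pairs with $R_i\in\tau$, $\mathbf{t}_i\in\{1,\dots,n\}^{\mathrm{ar}(R_i)}$, with variable $x_i$ for each; an assignment encodes the structure on $\{1,\dots,n\}$ whose tuples are the $(R_i,\mathbf{t}_i)$ with $x_i=1$. A family $\{H_n\}_{n\ge1}$ (one program per $n$ over these variables) defines $\mathcal{C}$ if $H_n$ accepts exactly the encodings of structures of domain size $n$ in $\mathcal{C}$. It is read-once if for every $n$ and every structure of domain size $n$ in $\mathcal{C}$, $H_n$ has an accepting path on which each label occurs on at most one arc. Size $O(n^j)$ means $|V(H_n)|=O(n^j)$. A $(j,k)$-path decomposition of $\mathbf{S}$ is a sequence $S_0,\dots,S_{m-1}$ of subsets of $S$ such that each $\tau$-tuple has all entries in some $S_\ell$, elements of $S_i\cap S_{i'}$ ($i<i'$) lie in all $S_\ell$ with $i<\ell<i'$, $|S_\ell|\le k$ and $|S_\ell\cap S_{\ell+1}|\le j$. -}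

module Defs where

open import Data.Nat using (ℕ; zero; suc; _+_; _*_; _^_; _≤_; _<_; _⊔_)
open import Data.Fin using (Fin; zero; suc; toℕ)
open import Data.Fin.Subset using (Subset; _∈_; _∩_; ∣_∣)
open import Data.Vec using (Vec; lookup; map)
open import Data.List using (List; []; _∷_; foldr; allFin)
import Data.List as L
open import Data.List.Membership.Propositional using () renaming (_∈_ to _∈ₗ_)
open import Data.List.Relation.Unary.Unique.Propositional using (Unique)
open import Data.Bool using (Bool; true; false; _∧_; not; _xor_)
open import Data.Maybe using (Maybe; just; nothing)
open import Data.Product using (Σ; ∃; ∃-syntax; _×_; _,_)
open import Data.Sum using (_⊎_)
open import Data.Unit using (⊤)
open import Relation.Binary.PropositionalEquality using (_≡_; _≢_)
open import Relation.Nullary using (¬_)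
open import Function.Definitions using (Injective)

record Sig : Set where
  field
    nsym : ℕ
    ar   : Fin nsym → ℕ
open Sig public

maxArity : Sig → ℕ
maxArity τ = foldr _⊔_ 0 (L.map (ar τ) (allFin (nsym τ)))

-- Successor τ-structures with domain {1,…,n}, represented as Fin n.
-- The built-in first/last/suc relations are determined by n and are
-- therefore not stored; only the τ-relations are.

record Str (τ : Sig) (n : ℕ) : Set where
  constructor mkStr
  field
    rel : (R : Fin (nsym τ)) → Vec (Fin n) (ar τ R) → Bool
open Str public

module _ {τ : Sig} where

  Class : Set₁
  Class = ∀ {n} → Str τ n → Set

  -- homomorphisms (w.r.t. the τ-relations only)
  Hom : ∀ {n m} → Str τ n → Str τ m → Set
  Hom {n} {m} A B = Σ (Fin n → Fin m) λ f →
    ∀ R t → rel A R t ≡ true → rel B R (map f t) ≡ true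

  HomClosed : Class → Set
  HomClosed C = ∀ {n m} (A : Str τ n) (B : Str τ m) → Hom A B → C A → C B

  record ProperSub {n m} (A : Str τ n) (B : Str τ m) : Set where
    field
      emb    : Fin m → Fin n
      inj    : Injective _≡_ _≡_ emb
      hom    : ∀ R u → rel B R u ≡ true → rel A R (map emb u) ≡ true
      proper : (∃[ x ] ∀ y → emb y ≢ x)
             ⊎ (∃[ R ] ∃[ t ] (rel A R t ≡ true
                  × (∀ u → map emb u ≡ t → rel B R u ≡ false)))

  Critical : Class → ∀ {n} → Str τ n → Set
  Critical C A = C A × (∀ {m} (B : Str τ m) → ProperSub A B → ¬ C B)

  -- The new element a' is placed at position 1
  -- (Fin.zero) and old elements are shifted by suc; since C is
  -- homomorphism-closed (hence closed under τ-isomorphism, regardless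
  -- of order) the placement is immaterial.

  -- T ⊆ T_a is given by a Boolean predicate on occurrences (t, R, i)
  record SplitOp {n} (A : Str τ n) : Set where
    field
      a        : Fin n
      T        : (R : Fin (nsym τ)) → Vec (Fin n) (ar τ R) → Fin (ar τ R) → Bool
      valid    : ∀ R t i → T R t i ≡ true → rel A R t ≡ true × lookup t i ≡ a
      nonempty : ∃[ R ] ∃[ t ] ∃[ i ] T R t i ≡ true
      proper   : ∃[ R ] ∃[ t ] ∃[ i ]
                   (rel A R t ≡ true × lookup t i ≡ a × T R t i ≡ false)

  allB : ∀ k → (Fin k → Bool) → Bool
  allB zero    p = true
  allB (suc k) p = p zero ∧ allB k (λ i → p (suc i))

  isZero : ∀ {n} → Fin (suc n) → Bool
  isZero zero    = true
  isZero (suc _) = false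

  unsplit : ∀ {n} → Fin n → Fin (suc n) → Fin n
  unsplit a zero    = a
  unsplit a (suc j) = j

  splitResult : ∀ {n} {A : Str τ n} → SplitOp A → Str τ (suc n)
  splitResult {n} {A} o = mkStr λ R u →
    let t = map (unsplit (SplitOp.a o)) u in
    rel A R t ∧ allB (ar τ R) (λ i → not (SplitOp.T o R t i xor isZero (lookup u i)))

  data Splits⁺ : ∀ {n m} → Str τ n → Str τ m → Set where
    one  : ∀ {n} {A : Str τ n} (o : SplitOp A) → Splits⁺ A (splitResult o)
    more : ∀ {n m} {A : Str τ n} {B : Str τ m} (o : SplitOp A) →
           Splits⁺ (splitResult o) B → Splits⁺ A B

  SplitMinimal : Class → ∀ {n} → Str τ n → Set
  SplitMinimal C A = C A × (∀ {m} (B : Str τ m) → Splits⁺ A B → ¬ C B)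

  record PathDecomp {n} (A : Str τ n) (j k : ℕ) : Set where
    field
      len    : ℕ
      bag    : Fin len → Subset n
      cover  : ∀ R t → rel A R t ≡ true → ∃[ ℓ ] ∀ i → lookup t i ∈ bag ℓ
      interp : ∀ (i ℓ i' : Fin len) x → toℕ i < toℕ ℓ → toℕ ℓ < toℕ i' →
               x ∈ bag i → x ∈ bag i' → x ∈ bag ℓ
      width  : ∀ ℓ → ∣ bag ℓ ∣ ≤ k
      adh    : ∀ (ℓ ℓ' : Fin len) → toℕ ℓ' ≡ suc (toℕ ℓ) → ∣ bag ℓ ∩ bag ℓ' ∣ ≤ j

record BP (X : Set) : Set where
  field
    size : ℕ
    src  : Fin size
    tgt  : Fin size
    arcs : List (Fin size × Fin size × Maybe X)   -- nothing = unlabeled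
open BP public

Active : ∀ {X : Set} → (X → Bool) → Maybe X → Set
Active σ nothing  = ⊤
Active σ (just x) = σ x ≡ true

data Walk {X : Set} (H : BP X) (σ : X → Bool) : Fin (size H) → Fin (size H) → Set where
  stop : ∀ {u} → Walk H σ u u
  step : ∀ {u w v} (l : Maybe X) → (u , w , l) ∈ₗ arcs H → Active σ l →
         Walk H σ w v → Walk H σ u v

labels : ∀ {X H σ u v} → Walk {X} H σ u v → List X
labels stop                       = []
labels (step nothing  _ _ w)      = labels w
labels (step (just x) _ _ w)      = x ∷ labels w

Accepts : ∀ {X} → BP X → (X → Bool) → Set
Accepts H σ = Walk H σ (src H) (tgt H)

Var : Sig → ℕ → Set
Var τ n = Σ (Fin (nsym τ)) λ R → Vec (Fin n) (ar τ R)

encode : ∀ {τ n} → Str τ n → Var τ n → Bool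
encode A (R , t) = rel A R t

module _ {τ : Sig} where

  Family : Set
  Family = (n : ℕ) → BP (Var τ n)

  Defines : Family → Class {τ} → Set
  Defines H C = ∀ n (A : Str τ n) → (Accepts (H n) (encode A) → C A) × (C A → Accepts (H n) (encode A))

  ReadOnce : Family → Class {τ} → Set
  ReadOnce H C = ∀ n (A : Str τ n) → C A →
    Σ (Accepts (H n) (encode A)) λ w → Unique (labels w)

  SizeO : Family → ℕ → Set
  SizeO H j = ∃[ c ] ∃[ N ] ∀ n → N ≤ n → size (H n) ≤ c * n ^ j

-- Let A be critical and split-minimal with n > j elements. For a colouring c : [n] → [M], the
-- copy of A placed at the points (x , c x) of an (n·M)-element domain is in C, so the program for
-- that size has a read-once accepting walk on it; by criticality the walk reads every tuple of A,
-- which orders the tuples. If for some c every cut of this order is crossed by at most j elements,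
-- the windows of the order form a (j , r + j)-path decomposition. Otherwise every c has a cut
-- crossed by more than j elements. Its fingerprint (the node of the walk at the cut, the tuples
-- read before and after it, the crossing set, and the colours outside that set) takes fewer than
-- M^n values once M is large, so two colourings c ≠ c' share one. At an element y with
-- c y ≢ c' y that crosses the cut, gluing the first part of the walk for c to the second part of
-- the walk for c' yields an accepted structure mapping homomorphically to a split of A at y,
-- contradicting split-minimality; outside the crossing, c and c' have the same colours.

module Submission where

open import Defs
open import Data.Nat as ℕ using (ℕ; zero; suc; _+_; _*_; _^_; _≤_; _<_; _∸_; _⊔_; z≤n; s≤s; _≤?_)
import Data.Nat.Properties as ℕP
open import Data.Nat.Tactic.RingSolver using (solve-∀)
open import Data.Fin as F using (Fin; zero; suc; toℕ)
import Data.Fin.Properties as FP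
open import Data.Fin.Subset using (Subset; _∈_; _∩_; _∪_; ∣_∣; ⁅_⁆; _⊆_) renaming (⊥ to ∅; ⊤ to full)
import Data.Fin.Subset.Properties as SP
open import Data.Vec as V using (Vec; []; _∷_; lookup; tabulate)
import Data.Vec.Properties as VP
open import Data.Vec.Relation.Unary.Any as VAny using (here; there)
open import Data.Vec.Membership.Propositional using () renaming (_∈_ to _∈ᵥ_)
import Data.Vec.Membership.Propositional.Properties as VMP
open import Data.List as L using (List; []; _∷_; take; drop; length)
import Data.List.Properties as LP
open import Data.List.Membership.Propositional using (lose; find) renaming (_∈_ to _∈ₗ_)
import Data.List.Membership.Propositional.Properties as LMP
open import Data.List.Relation.Unary.Any as Any using (Any; here; there)
import Data.List.Relation.Unary.Any.Properties as AnyP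
import Data.List.Relation.Unary.All as All
open import Data.List.Relation.Unary.AllPairs using (_∷_)
open import Data.List.Relation.Unary.Unique.Propositional using (Unique)
import Data.List.Relation.Binary.Sublist.Propositional.Properties as Sublist
open import Data.Bool using (Bool; true; false; _∧_; not; _xor_; if_then_else_)
import Data.Bool.Properties as BP
open import Data.Maybe using (Maybe; just; nothing; maybe)
open import Data.Product using (∃₂; ∃-syntax; _×_; _,_; proj₁; proj₂)
import Data.Product.Properties as PP
open import Data.Sum using (_⊎_; inj₁; inj₂; [_,_]′)
open import Data.Empty using (⊥; ⊥-elim)
open import Function using (_∘_; Inverse; mk⇔)
open import Relation.Binary.PropositionalEquality
open import Relation.Binary.Definitions using (DecidableEquality)
open import Relation.Nullary using (¬_; Dec; yes; no; does)
open import Relation.Nullary.Decidable using (dec-true; dec-false; does-⇔; _×-dec_; _⊎-dec_)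
open import Relation.Unary using (Decidable)
open import Axiom.UniquenessOfIdentityProofs using (module Decidable⇒UIP)

dec-true⁻ : ∀ {P : Set} (d : Dec P) → does d ≡ true → P
dec-true⁻ (yes p) _ = p

module _ {A : Set} where

  ∈-take⁻ : ∀ p {xs : List A} {x} → x ∈ₗ take p xs → x ∈ₗ xs
  ∈-take⁻ p = Sublist.Any-resp-⊆ (Sublist.take-⊆ p _)

  ∈-drop⁻ : ∀ p {xs : List A} {x} → x ∈ₗ drop p xs → x ∈ₗ xs
  ∈-drop⁻ p = Sublist.Any-resp-⊆ (Sublist.drop-⊆ p _)

  take-drop-disjoint : ∀ p {xs : List A} {x} → Unique xs → x ∈ₗ take p xs → ¬ x ∈ₗ drop p xs
  take-drop-disjoint (suc p) {y ∷ xs} (y∉xs ∷ _) (here refl) x∈drop =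
    All.lookup y∉xs (∈-drop⁻ p x∈drop) refl
  take-drop-disjoint (suc p) {y ∷ xs} (_ ∷ u) (there x∈take) = take-drop-disjoint p u x∈take

  drop-lookup : ∀ (xs : List A) i → drop (toℕ i) xs ≡ L.lookup xs i ∷ drop (suc (toℕ i)) xs
  drop-lookup (x ∷ xs) zero    = refl
  drop-lookup (x ∷ xs) (suc i) = drop-lookup xs i

  Any-take-suc⁻ : ∀ {P : A → Set} (xs : List A) i →
                  Any P (take (suc (toℕ i)) xs) → Any P (take (toℕ i) xs) ⊎ P (L.lookup xs i)
  Any-take-suc⁻ xs i a with AnyP.++⁻ (take (toℕ i) xs) (subst (Any _) (LP.take-suc xs i) a)
  ... | inj₁ earlier    = inj₁ earlier
  ... | inj₂ (here now) = inj₂ now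

  lookupMaybe : List A → ℕ → Maybe A
  lookupMaybe []       _       = nothing
  lookupMaybe (x ∷ xs) zero    = just x
  lookupMaybe (x ∷ xs) (suc k) = lookupMaybe xs k

  lookupMaybe-∈ : ∀ {xs : List A} {x} → x ∈ₗ xs → ∃[ k ] (k < length xs × lookupMaybe xs k ≡ just x)
  lookupMaybe-∈ (here refl) = zero , s≤s z≤n , refl
  lookupMaybe-∈ (there x∈xs) with lookupMaybe-∈ x∈xs
  ... | k , k<len , eq = suc k , s≤s k<len , eq

∈ᵥ⇒lookup : ∀ {A : Set} {k} {x : A} {t : Vec A k} → x ∈ᵥ t → ∃[ i ] lookup t i ≡ x
∈ᵥ⇒lookup (here refl) = zero , refl
∈ᵥ⇒lookup (there x∈t) with ∈ᵥ⇒lookup x∈t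
... | i , eq = suc i , eq

_∈ᵥ?_ : ∀ {n k} (x : Fin n) (t : Vec (Fin n) k) → Dec (x ∈ᵥ t)
x ∈ᵥ? t = VAny.any? (x F.≟_) t

module _ {n : ℕ} {P : Fin n → Set} (P? : Decidable P) where

  subsetOf : Subset n
  subsetOf = tabulate (does ∘ P?)

  ∈-subsetOf⁺ : ∀ {x} → P x → x ∈ subsetOf
  ∈-subsetOf⁺ {x} px = VP.lookup⇒[]= x _ (trans (VP.lookup∘tabulate _ x) (dec-true (P? x) px))

  ∈-subsetOf⁻ : ∀ {x} → x ∈ subsetOf → P x
  ∈-subsetOf⁻ {x} x∈ = dec-true⁻ (P? x) (trans (sym (VP.lookup∘tabulate _ x)) (VP.[]=⇒lookup x∈))

outsideList : ∀ {n} → Subset n → List (Fin n)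
outsideList []          = []
outsideList (true ∷ p)  = L.map suc (outsideList p)
outsideList (false ∷ p) = zero ∷ L.map suc (outsideList p)

length-outsideList : ∀ {n} (p : Subset n) → length (outsideList p) + ∣ p ∣ ≡ n
length-outsideList []          = refl
length-outsideList (true ∷ p)  = begin
  length (L.map suc (outsideList p)) + suc ∣ p ∣ ≡⟨ cong (_+ suc ∣ p ∣) (LP.length-map suc (outsideList p)) ⟩
  length (outsideList p) + suc ∣ p ∣             ≡⟨ ℕP.+-suc _ _ ⟩
  suc (length (outsideList p) + ∣ p ∣)           ≡⟨ cong suc (length-outsideList p) ⟩
  suc _                                          ∎
  where open ≡-Reasoning
length-outsideList (false ∷ p) =
  cong suc (trans (cong (_+ ∣ p ∣) (LP.length-map suc (outsideList p))) (length-outsideList p))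

∈-outsideList : ∀ {n} (p : Subset n) {x} → lookup p x ≡ false → x ∈ₗ outsideList p
∈-outsideList (false ∷ p) {zero}  _ = here refl
∈-outsideList (true ∷ p)  {suc x} e = LMP.∈-map⁺ suc (∈-outsideList p e)
∈-outsideList (false ∷ p) {suc x} e = there (LMP.∈-map⁺ suc (∈-outsideList p e))

∣p∪q∣≤∣p∣+∣q∣ : ∀ {n} (p q : Subset n) → ∣ p ∪ q ∣ ≤ ∣ p ∣ + ∣ q ∣
∣p∪q∣≤∣p∣+∣q∣ []            []            = z≤n
∣p∪q∣≤∣p∣+∣q∣ (false ∷ p)   (false ∷ q)   = ∣p∪q∣≤∣p∣+∣q∣ p q
∣p∪q∣≤∣p∣+∣q∣ (false ∷ p)   (true ∷ q)    =
  ℕP.≤-trans (s≤s (∣p∪q∣≤∣p∣+∣q∣ p q)) (ℕP.≤-reflexive (sym (ℕP.+-suc _ _)))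
∣p∪q∣≤∣p∣+∣q∣ (true ∷ p)    (false ∷ q)   = s≤s (∣p∪q∣≤∣p∣+∣q∣ p q)
∣p∪q∣≤∣p∣+∣q∣ (true ∷ p)    (true ∷ q)    =
  s≤s (ℕP.≤-trans (∣p∪q∣≤∣p∣+∣q∣ p q) (ℕP.+-monoʳ-≤ ∣ p ∣ (ℕP.n≤1+n _)))

entries : ∀ {n k} → Vec (Fin n) k → Subset n
entries t = subsetOf (_∈ᵥ? t)

∣entries∣≤ : ∀ {n k} (t : Vec (Fin n) k) → ∣ entries t ∣ ≤ k
∣entries∣≤ {n} [] = ℕP.≤-trans (SP.p⊆q⇒∣p∣≤∣q∣ none) (ℕP.≤-reflexive (SP.∣⊥∣≡0 n))
  where
  none : entries [] ⊆ ∅ {n}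
  none x∈ = ⊥-elim (noEntry (∈-subsetOf⁻ (_∈ᵥ? []) x∈))
    where
    noEntry : ∀ {x} → ¬ x ∈ᵥ []
    noEntry ()
∣entries∣≤ {n} (y ∷ t) = begin
    ∣ entries (y ∷ t) ∣       ≤⟨ SP.p⊆q⇒∣p∣≤∣q∣ split ⟩
    ∣ ⁅ y ⁆ ∪ entries t ∣     ≤⟨ ∣p∪q∣≤∣p∣+∣q∣ ⁅ y ⁆ (entries t) ⟩
    ∣ ⁅ y ⁆ ∣ + ∣ entries t ∣ ≡⟨ cong (_+ ∣ entries t ∣) (SP.∣⁅x⁆∣≡1 y) ⟩
    suc ∣ entries t ∣         ≤⟨ s≤s (∣entries∣≤ t) ⟩
    suc _                     ∎
  where
  open ℕP.≤-Reasoning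
  split : entries (y ∷ t) ⊆ ⁅ y ⁆ ∪ entries t
  split x∈ = SP.x∈p∪q⁺ (cases (∈-subsetOf⁻ (_∈ᵥ? (y ∷ t)) x∈))
    where
    cases : ∀ {x} → x ∈ᵥ y ∷ t → x ∈ ⁅ y ⁆ ⊎ x ∈ entries t
    cases (here refl)  = inj₁ (SP.x∈⁅x⁆ y)
    cases (there x∈t) = inj₂ (∈-subsetOf⁺ (_∈ᵥ? t) x∈t)

funToFin-cong : ∀ {m k} {f g : Fin m → Fin k} → (∀ x → f x ≡ g x) → F.funToFin f ≡ F.funToFin g
funToFin-cong {zero}  eq = refl
funToFin-cong {suc m} eq = cong₂ F.combine (eq zero) (funToFin-cong (eq ∘ suc))

funToFin-injective : ∀ {m k} (f g : Fin m → Fin k) → F.funToFin f ≡ F.funToFin g → ∀ x → f x ≡ g x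
funToFin-injective f g eq x = begin
  f x                          ≡⟨ FP.finToFun-funToFin f x ⟨
  F.finToFun (F.funToFin f) x  ≡⟨ cong (λ i → F.finToFun i x) eq ⟩
  F.finToFun (F.funToFin g) x  ≡⟨ FP.finToFun-funToFin g x ⟩
  g x                          ∎
  where open ≡-Reasoning

finToFun-injective : ∀ {m k} (i i' : Fin (k ^ m)) → (∀ x → F.finToFun {k} {m} i x ≡ F.finToFun i' x) → i ≡ i'
finToFun-injective {m} {k} i i' eq = begin
  i                          ≡⟨ FP.funToFin-finToFin {m} {k} i ⟨
  F.funToFin (F.finToFun {k} {m} i)  ≡⟨ funToFin-cong eq ⟩
  F.funToFin (F.finToFun {k} {m} i') ≡⟨ FP.funToFin-finToFin {m} {k} i' ⟩
  i'                         ∎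
  where open ≡-Reasoning

bitsToFin : ∀ {m} → (Fin m → Bool) → Fin (2 ^ m)
bitsToFin f = F.funToFin (Inverse.from FP.2↔Bool ∘ f)

bitsToFin-injective : ∀ {m} (f g : Fin m → Bool) → bitsToFin f ≡ bitsToFin g → ∀ x → f x ≡ g x
bitsToFin-injective f g eq x = begin
  f x                   ≡⟨ Inverse.strictlyInverseˡ FP.2↔Bool (f x) ⟨
  to (from (f x))       ≡⟨ cong to (funToFin-injective _ _ eq x) ⟩
  to (from (g x))       ≡⟨ Inverse.strictlyInverseˡ FP.2↔Bool (g x) ⟩
  g x                   ∎
  where
  open ≡-Reasoning
  open Inverse FP.2↔Bool using (to; from)

allVectors : ∀ n k → List (Vec (Fin n) k)
allVectors n k = L.map (tabulate ∘ F.finToFun) (L.allFin (n ^ k))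

∈-allVectors : ∀ {n k} (t : Vec (Fin n) k) → t ∈ₗ allVectors n k
∈-allVectors t =
  subst (_∈ₗ _) decode (LMP.∈-map⁺ (tabulate ∘ F.finToFun) (LMP.∈-allFin (F.funToFin (lookup t))))
  where
  decode : tabulate (F.finToFun (F.funToFin (lookup t))) ≡ t
  decode = trans (VP.tabulate-cong (FP.finToFun-funToFin (lookup t))) (VP.tabulate∘lookup t)

allVars : ∀ τ n → List (Var τ n)
allVars τ n = L.concatMap (λ R → L.map (R ,_) (allVectors n (ar τ R))) (L.allFin (nsym τ))

∈-allVars : ∀ {τ n} (v : Var τ n) → v ∈ₗ allVars τ n
∈-allVars {τ} {n} (R , t) = LMP.∈-concatMap⁺ (λ R → L.map (R ,_) (allVectors n (ar τ R)))
  (lose (LMP.∈-allFin R) (LMP.∈-map⁺ (R ,_) (∈-allVectors t)))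

_≟ᵛ_ : ∀ {τ n} → DecidableEquality (Var τ n)
_≟ᵛ_ = PP.≡-dec F._≟_ (VP.≡-dec F._≟_)

_∈ₗ?_ : ∀ {τ n} (v : Var τ n) (vs : List (Var τ n)) → Dec (v ∈ₗ vs)
v ∈ₗ? vs = Any.any? (v ≟ᵛ_) vs

agree-on-enumeration : ∀ {A : Set} {P Q : A → Set} (P? : Decidable P) (Q? : Decidable Q) (xs : List A) →
  (∀ v → v ∈ₗ xs) → (∀ k → does (P? (L.lookup xs k)) ≡ does (Q? (L.lookup xs k))) →
  ∀ {v} → P v → Q v
agree-on-enumeration {P = P} {Q} P? Q? xs complete agree {v} pv =
  subst Q (sym v≡) (dec-true⁻ (Q? _) (trans (sym (agree k)) (dec-true (P? _) (subst P v≡ pv))))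
  where
  k : Fin (length xs)
  k = Any.index (complete v)
  v≡ : v ≡ L.lookup xs k
  v≡ = AnyP.lookup-index (complete v)

^-distribʳ-* : ∀ a b k → (a * b) ^ k ≡ a ^ k * b ^ k
^-distribʳ-* a b zero    = refl
^-distribʳ-* a b (suc k) = trans (cong (a * b *_) (^-distribʳ-* a b k)) (swap a b (a ^ k) (b ^ k))
  where
  swap : ∀ a b x y → a * b * (x * y) ≡ a * x * (b * y)
  swap = solve-∀

-- (1 + M)^L ≤ 2^L M^L turns the left side into B M^(j+L) with B < M.
s*[K*[1+M]^L]<M^[1+j+L] : ∀ c a j K L M s → s ≤ c * (a * M) ^ j → c * a ^ j * K * 2 ^ L < M →
                          s * (K * suc M ^ L) < M ^ suc (j + L)
s*[K*[1+M]^L]<M^[1+j+L] c a j K L zero      s _   ()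
s*[K*[1+M]^L]<M^[1+j+L] c a j K L M@(suc _) s s≤ B<M = begin-strict
    s * (K * suc M ^ L)
      ≤⟨ ℕP.*-mono-≤ s≤ (ℕP.*-monoʳ-≤ K (ℕP.^-monoˡ-≤ L sM≤2M)) ⟩
    c * (a * M) ^ j * (K * (2 * M) ^ L)
      ≡⟨ cong₂ (λ x y → c * x * (K * y)) (^-distribʳ-* a M j) (^-distribʳ-* 2 M L) ⟩
    c * (a ^ j * M ^ j) * (K * (2 ^ L * M ^ L))
      ≡⟨ regroup c (a ^ j) (M ^ j) K (2 ^ L) (M ^ L) ⟩
    B * (M ^ j * M ^ L)
      ≡⟨ cong (B *_) (ℕP.^-distribˡ-+-* M j L) ⟨
    B * M ^ (j + L)
      <⟨ ℕP.*-monoˡ-< (M ^ (j + L)) {{ℕ.>-nonZero (ℕP.m^n>0 M (j + L))}} B<M ⟩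
    M * M ^ (j + L)
      ∎
  where
  open ℕP.≤-Reasoning
  B : ℕ
  B = c * a ^ j * K * 2 ^ L
  sM≤2M : suc M ≤ 2 * M
  sM≤2M = ℕP.≤-trans (ℕP.+-monoˡ-≤ M (s≤s z≤n))
                      (ℕP.≤-reflexive (cong (M +_) (sym (ℕP.+-identityʳ M))))
  regroup : ∀ c aj Mj K tL ML → c * (aj * Mj) * (K * (tL * ML)) ≡ c * aj * K * tL * (Mj * ML)
  regroup = solve-∀

module _ {X : Set} {H : BP X} where

  labels-active : ∀ {σ u v} (w : Walk H σ u v) {x} → x ∈ₗ labels w → σ x ≡ true
  labels-active (step nothing  _ _   w) x∈ = labels-active w x∈
  labels-active (step (just y) _ act w) (here refl) = act
  labels-active (step (just y) _ _   w) (there x∈) = labels-active w x∈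

  reassign : ∀ {σ σ' u v} (w : Walk H σ u v) → (∀ {x} → x ∈ₗ labels w → σ' x ≡ true) → Walk H σ' u v
  reassign stop                      _      = stop
  reassign (step nothing  arc _   w) active = step nothing arc _ (reassign w active)
  reassign (step (just y) arc _   w) active =
    step (just y) arc (active (here refl)) (reassign w (active ∘ there))

  _++ᵂ_ : ∀ {σ u m v} → Walk H σ u m → Walk H σ m v → Walk H σ u v
  stop              ++ᵂ w₂ = w₂
  step l arc act w₁ ++ᵂ w₂ = step l arc act (w₁ ++ᵂ w₂)

  record WalkSplit {σ u v} (w : Walk H σ u v) (p : ℕ) : Set where
    field
      middle  : Fin (size H)
      prefix  : Walk H σ u middle
      suffix  : Walk H σ middle v
      labels-prefix : labels prefix ≡ take p (labels w)
      labels-suffix : labels suffix ≡ drop p (labels w)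

  splitWalkAt : ∀ {σ u v} (w : Walk H σ u v) p → WalkSplit w p
  splitWalkAt stop p = record
    { prefix = stop ; suffix = stop
    ; labels-prefix = sym (LP.take-[] p) ; labels-suffix = sym (LP.drop-[] p) }
  splitWalkAt (step nothing arc act w) p = record
    { prefix = step nothing arc act prefix ; suffix = suffix
    ; labels-prefix = labels-prefix ; labels-suffix = labels-suffix }
    where open WalkSplit (splitWalkAt w p)
  splitWalkAt w@(step (just y) _ _ _) zero =
    record { prefix = stop ; suffix = w ; labels-prefix = refl ; labels-suffix = refl }
  splitWalkAt (step (just y) arc act w) (suc p) = record
    { prefix = step (just y) arc act prefix ; suffix = suffix
    ; labels-prefix = cong (y ∷_) labels-prefix ; labels-suffix = labels-suffix }
    where open WalkSplit (splitWalkAt w p)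

ar≤maxArity : ∀ τ R → ar τ R ≤ maxArity τ
ar≤maxArity τ R = ≤-foldr-⊔ (LMP.∈-map⁺ (ar τ) (LMP.∈-allFin R))
  where
  ≤-foldr-⊔ : ∀ {xs x} → x ∈ₗ xs → x ≤ L.foldr _⊔_ 0 xs
  ≤-foldr-⊔ {y ∷ xs} (here refl) = ℕP.m≤m⊔n y _
  ≤-foldr-⊔ {y ∷ xs} (there x∈) = ℕP.m≤n⇒m≤o⊔n y (≤-foldr-⊔ x∈)

singleBagDecomp : ∀ {τ n} (A : Str τ n) j k → n ≤ k → PathDecomp A j k
singleBagDecomp {n = n} A j k n≤k = record
  { len    = 1
  ; bag    = λ _ → full
  ; cover  = λ _ _ _ → zero , λ _ → SP.∈⊤
  ; interp = λ { zero zero zero _ () }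
  ; width  = λ _ → ℕP.≤-trans (ℕP.≤-reflexive (SP.∣⊤∣≡n n)) n≤k
  ; adh    = λ { zero zero () } }

module _ {τ : Sig} {n : ℕ} where

  _∖_ : Str τ n → Var τ n → Str τ n
  rel (A ∖ v) R t = rel A R t ∧ not (does ((R , t) ≟ᵛ v))

  ∖-tuple⁺ : ∀ {A : Str τ n} {v u} → encode A u ≡ true → u ≢ v → encode (A ∖ v) u ≡ true
  ∖-tuple⁺ {v = v} {u} e u≢v = cong₂ (λ a b → a ∧ not b) e (dec-false (u ≟ᵛ v) u≢v)

  ∖-tuple⁻ : ∀ {A : Str τ n} {v u} → encode (A ∖ v) u ≡ true → encode A u ≡ true
  ∖-tuple⁻ {A} {v} {R , t} = BP.∧-conicalˡ (rel A R t) _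

  ∖-removes : ∀ (A : Str τ n) v → encode (A ∖ v) v ≡ false
  ∖-removes A (R , t) =
    trans (cong (λ b → rel A R t ∧ not b) (dec-true ((R , t) ≟ᵛ (R , t)) refl)) (BP.∧-zeroʳ _)

  ∖-tuple⇒≢ : ∀ {A : Str τ n} {v u} → encode (A ∖ v) u ≡ true → u ≢ v
  ∖-tuple⇒≢ {A} {v} e refl with () ← trans (sym e) (∖-removes A v)

  ∖-properSub : ∀ {A : Str τ n} {v} → encode A v ≡ true → ProperSub A (A ∖ v)
  ∖-properSub {A} {v@(R , t)} e = record
    { emb    = λ x → x
    ; inj    = λ eq → eq
    ; hom    = λ R u e' → subst (λ u' → rel A R u' ≡ true) (sym (VP.map-id u)) (∖-tuple⁻ {A} {v} {R , u} e')
    ; proper = inj₂ (R , t , e , λ u eq → subst (λ u' → rel (A ∖ v) R u' ≡ false)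
                                            (trans (sym eq) (VP.map-id u)) (∖-removes A v)) }

  allB-true : ∀ k {q : Fin k → Bool} → (∀ i → q i ≡ true) → allB {τ = τ} k q ≡ true
  allB-true zero    _   = refl
  allB-true (suc k) all = cong₂ _∧_ (all zero) (allB-true k (all ∘ suc))

  splitResult-tuple : ∀ {A : Str τ n} (o : SplitOp A) {R} (u : Vec (Fin (suc n)) (ar τ R)) {t} →
    V.map (unsplit {τ = τ} (SplitOp.a o)) u ≡ t → rel A R t ≡ true →
    (∀ i → SplitOp.T o R t i ≡ isZero {τ = τ} (lookup u i)) → rel (splitResult o) R u ≡ true
  splitResult-tuple o {R} u refl e selects = cong₂ _∧_ e (allB-true (ar τ R) λ i →
    trans (cong (λ b → not (b xor isZero {τ = τ} (lookup u i))) (selects i))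
          (cong not (BP.xor-same (isZero {τ = τ} (lookup u i)))))

-- Path decompositions from linear orderings of the tuples

module _ {τ : Sig} {n : ℕ} where

  Occurs : Fin n → Var τ n → Set
  Occurs x (_ , t) = x ∈ᵥ t

  occurs? : ∀ x → Decidable (Occurs x)
  occurs? x (_ , t) = x ∈ᵥ? t

  Spans : List (Var τ n) → ℕ → ℕ → Fin n → Set
  Spans ts a b x = Any (Occurs x) (take a ts) × Any (Occurs x) (drop b ts)

  spans? : ∀ ts a b → Decidable (Spans ts a b)
  spans? ts a b x = Any.any? (occurs? x) (take a ts) ×-dec Any.any? (occurs? x) (drop b ts)

  Spans-mono : ∀ {ts a a' b b' x} → a ≤ a' → b' ≤ b → Spans ts a b x → Spans ts a' b' x
  Spans-mono a≤a' b'≤b (before , after) =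
    Sublist.Any-resp-⊆ (Sublist.take⁺ a≤a') before , Sublist.Any-resp-⊆ (Sublist.drop⁺-≥ b'≤b) after

  crossing : List (Var τ n) → ℕ → Subset n
  crossing ts p = subsetOf (spans? ts p p)

  CutwidthAtMost : ℕ → List (Var τ n) → Set
  CutwidthAtMost j ts = ∀ (p : Fin (suc (length ts))) → ∣ crossing ts (toℕ p) ∣ ≤ j

  pathDecomp-fromCutwidth : ∀ {j} (A : Str τ n) (ts : List (Var τ n)) →
    (∀ {v} → encode A v ≡ true → v ∈ₗ ts) → CutwidthAtMost j ts → PathDecomp A j (maxArity τ + j)
  pathDecomp-fromCutwidth {j} A ts covers narrow = record
    { len = length ts ; bag = bag ; cover = cover ; interp = interp ; width = width ; adh = adh }
    where
    bag : Fin (length ts) → Subset n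
    bag ℓ = subsetOf (spans? ts (suc (toℕ ℓ)) (toℕ ℓ))

    ∈bag⁻ : ∀ {ℓ x} → x ∈ bag ℓ → Spans ts (suc (toℕ ℓ)) (toℕ ℓ) x
    ∈bag⁻ {ℓ} = ∈-subsetOf⁻ (spans? ts (suc (toℕ ℓ)) (toℕ ℓ))

    occurs⇒∈bag : ∀ ℓ {x} → Occurs x (L.lookup ts ℓ) → x ∈ bag ℓ
    occurs⇒∈bag ℓ occ = ∈-subsetOf⁺ (spans? ts (suc (toℕ ℓ)) (toℕ ℓ))
      ( subst (Any _) (sym (LP.take-suc ts ℓ)) (AnyP.++⁺ʳ (take (toℕ ℓ) ts) (here occ))
      , subst (Any _) (sym (drop-lookup ts ℓ)) (here occ) )

    cover : ∀ R t → rel A R t ≡ true → ∃[ ℓ ] ∀ i → lookup t i ∈ bag ℓ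
    cover R t e = Any.index (covers e) , λ i →
      occurs⇒∈bag _ (subst (Occurs (lookup t i)) (AnyP.lookup-index (covers e)) (VMP.∈-lookup i t))

    interp : ∀ (i ℓ i' : Fin (length ts)) x → toℕ i < toℕ ℓ → toℕ ℓ < toℕ i' →
             x ∈ bag i → x ∈ bag i' → x ∈ bag ℓ
    interp i ℓ i' x i<ℓ ℓ<i' x∈i x∈i' = ∈-subsetOf⁺ (spans? ts (suc (toℕ ℓ)) (toℕ ℓ))
      (Spans-mono (s≤s (ℕP.<⇒≤ i<ℓ)) (ℕP.<⇒≤ ℓ<i') (proj₁ (∈bag⁻ x∈i) , proj₂ (∈bag⁻ x∈i')))

    ∈bag⇒entries⊎crossing : ∀ ℓ → bag ℓ ⊆ entries (proj₂ (L.lookup ts ℓ)) ∪ crossing ts (toℕ ℓ)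
    ∈bag⇒entries⊎crossing ℓ {x} x∈ = SP.x∈p∪q⁺ (cases (Any-take-suc⁻ ts ℓ (proj₁ (∈bag⁻ x∈))))
      where
      cases : Any (Occurs x) (take (toℕ ℓ) ts) ⊎ Occurs x (L.lookup ts ℓ) →
              x ∈ entries (proj₂ (L.lookup ts ℓ)) ⊎ x ∈ crossing ts (toℕ ℓ)
      cases (inj₁ earlier) =
        inj₂ (∈-subsetOf⁺ (spans? ts (toℕ ℓ) (toℕ ℓ)) (earlier , proj₂ (∈bag⁻ x∈)))
      cases (inj₂ now)     = inj₁ (∈-subsetOf⁺ (_∈ᵥ? proj₂ (L.lookup ts ℓ)) now)

    width : ∀ ℓ → ∣ bag ℓ ∣ ≤ maxArity τ + j
    width ℓ = begin
      ∣ bag ℓ ∣                          ≤⟨ SP.p⊆q⇒∣p∣≤∣q∣ (∈bag⇒entries⊎crossing ℓ) ⟩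
      ∣ entries t ∪ crossing ts (toℕ ℓ) ∣ ≤⟨ ∣p∪q∣≤∣p∣+∣q∣ (entries t) _ ⟩
      ∣ entries t ∣ + ∣ crossing ts (toℕ ℓ) ∣
        ≤⟨ ℕP.+-mono-≤ (ℕP.≤-trans (∣entries∣≤ t) (ar≤maxArity τ _))
                       (subst (λ p → ∣ crossing ts p ∣ ≤ j) (FP.toℕ-inject₁ ℓ) (narrow (F.inject₁ ℓ))) ⟩
      maxArity τ + j                     ∎
      where
      open ℕP.≤-Reasoning
      t : Vec (Fin n) (ar τ (proj₁ (L.lookup ts ℓ)))
      t = proj₂ (L.lookup ts ℓ)

    adh : ∀ (ℓ ℓ' : Fin (length ts)) → toℕ ℓ' ≡ suc (toℕ ℓ) → ∣ bag ℓ ∩ bag ℓ' ∣ ≤ j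
    adh ℓ ℓ' ℓ'≡1+ℓ = ℕP.≤-trans (SP.p⊆q⇒∣p∣≤∣q∣ shared) (narrow (suc ℓ))
      where
      shared : bag ℓ ∩ bag ℓ' ⊆ crossing ts (suc (toℕ ℓ))
      shared x∈ with SP.x∈p∩q⁻ (bag ℓ) (bag ℓ') x∈
      ... | x∈ℓ , x∈ℓ' = ∈-subsetOf⁺ (spans? ts (suc (toℕ ℓ)) (suc (toℕ ℓ)))
        (proj₁ (∈bag⁻ x∈ℓ) , subst (λ b → Any _ (drop b ts)) ℓ'≡1+ℓ (proj₂ (∈bag⁻ x∈ℓ')))

-- Fin N is Fin n × Fin M via Fin.combine; a colouring c places x at the point (x , c x), and
-- Copy c is A placed along c with every other point isolated.
module Blowup {τ : Sig} {n : ℕ} (A : Str τ n) (M : ℕ) where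

  N : ℕ
  N = n * M

  Colouring : Set
  Colouring = Fin n → Fin M

  base : Fin N → Fin n
  base z = proj₁ (F.remQuot M z)

  place : Colouring → Fin n → Fin N
  place c x = F.combine x (c x)

  base-place : ∀ c x → base (place c x) ≡ x
  base-place c x = cong proj₁ (FP.remQuot-combine x (c x))

  place-injective : ∀ {c c' x y} → place c x ≡ place c' y → x ≡ y × c x ≡ c' y
  place-injective = FP.combine-injective _ _ _ _

  lift : Colouring → Var τ n → Var τ N
  lift c (R , t) = R , V.map (place c) t

  unlift : Var τ N → Var τ n
  unlift (R , u) = R , V.map base u

  unlift-lift : ∀ c v → unlift (lift c v) ≡ v
  unlift-lift c (R , t) = cong (R ,_) (begin
    V.map base (V.map (place c) t) ≡⟨ VP.map-∘ base (place c) t ⟨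
    V.map (base ∘ place c) t       ≡⟨ VP.map-cong (base-place c) t ⟩
    V.map (λ x → x) t              ≡⟨ VP.map-id t ⟩
    t                              ∎)
    where open ≡-Reasoning

  lifted-entries : ∀ {c R u} → (R , u) ≡ lift c (unlift (R , u)) → u ≡ V.map (place c) (V.map base u)
  lifted-entries = PP.,-injectiveʳ-UIP (Decidable⇒UIP.≡-irrelevant F._≟_)

  Copy : Colouring → Str τ N
  rel (Copy c) R u = encode A (unlift (R , u)) ∧ does ((R , u) ≟ᵛ lift c (unlift (R , u)))

  Copy-tuple⁻ : ∀ c {u} → encode (Copy c) u ≡ true → encode A (unlift u) ≡ true × u ≡ lift c (unlift u)
  Copy-tuple⁻ c {u} e = BP.∧-conicalˡ _ _ e , dec-true⁻ (u ≟ᵛ lift c (unlift u)) (BP.∧-conicalʳ _ _ e)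

  Copy-tuple⁺ : ∀ c {v} → encode A v ≡ true → encode (Copy c) (lift c v) ≡ true
  Copy-tuple⁺ c {v} e = subst (λ w → encode A w ∧ does (lift c v ≟ᵛ lift c w) ≡ true) (sym (unlift-lift c v))
                              (cong₂ _∧_ e (dec-true (lift c v ≟ᵛ lift c v) refl))

  Copy-hom : ∀ c → Hom A (Copy c)
  Copy-hom c = place c , λ R t → Copy-tuple⁺ c {R , t}

-- The order in which a read-once program reads the tuples of a copy

module ReadOrder {τ : Sig} {C : Class {τ}} (hc : HomClosed C) {H : Family {τ}} (def : Defines H C)
                 (ro : ReadOnce H C) {n : ℕ} {A : Str τ n} (crit : Critical C A) (M : ℕ) where

  open Blowup A M public

  Copy∈C : ∀ c → C (Copy c)
  Copy∈C c = hc A (Copy c) (Copy-hom c) (proj₁ crit)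

  walk : ∀ c → Accepts (H N) (encode (Copy c))
  walk c = proj₁ (ro N (Copy c) (Copy∈C c))

  read : Colouring → List (Var τ N)
  read c = labels (walk c)

  read-unique : ∀ c → Unique (read c)
  read-unique c = proj₂ (ro N (Copy c) (Copy∈C c))

  read-Copy : ∀ c {u} → u ∈ₗ read c → encode A (unlift u) ≡ true × u ≡ lift c (unlift u)
  read-Copy c u∈ = Copy-tuple⁻ c (labels-active (walk c) u∈)

  order : Colouring → List (Var τ n)
  order c = L.map unlift (read c)

  order-tuple : ∀ c {v} → v ∈ₗ order c → encode A v ≡ true
  order-tuple c v∈ with LMP.∈-map⁻ unlift v∈
  ... | u , u∈ , refl = proj₁ (read-Copy c u∈)

  -- Criticality: a tuple that is never read could be deleted from A.
  lift∈read : ∀ c {v} → encode A v ≡ true → lift c v ∈ₗ read c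
  lift∈read c {v} e with lift c v ∈ₗ? read c
  ... | yes v∈ = v∈
  ... | no  v∉ = ⊥-elim (proj₂ crit (A ∖ v) (∖-properSub e) (hc _ _ unlift-hom (proj₁ (def N _) avoiding)))
    where
    avoiding : Accepts (H N) (encode (Copy c ∖ lift c v))
    avoiding = reassign (walk c) λ u∈ →
      ∖-tuple⁺ {A = Copy c} (labels-active (walk c) u∈) λ { refl → v∉ u∈ }
    unlift-hom : Hom (Copy c ∖ lift c v) (A ∖ v)
    unlift-hom = base , λ R u e' →
      let A-tuple , lifted = Copy-tuple⁻ c (∖-tuple⁻ {A = Copy c} {u = R , u} e') in
      ∖-tuple⁺ {A = A} A-tuple λ eq → ∖-tuple⇒≢ {A = Copy c} e' (trans lifted (cong (lift c) eq))

  order-covers : ∀ c {v} → encode A v ≡ true → v ∈ₗ order c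
  order-covers c {v} e = subst (_∈ₗ order c) (unlift-lift c v) (LMP.∈-map⁺ unlift (lift∈read c e))

  Before After : Colouring → ℕ → Var τ n → Set
  Before c p v = v ∈ₗ take p (order c)
  After  c p v = v ∈ₗ drop p (order c)

  lift-∈ : ∀ c {ys} → (∀ {u} → u ∈ₗ ys → u ∈ₗ read c) →
           ∀ {v} → v ∈ₗ L.map unlift ys → lift c v ∈ₗ ys
  lift-∈ c ys⊆ v∈ with LMP.∈-map⁻ unlift v∈
  ... | u , u∈ , refl = subst (_∈ₗ _) (proj₂ (read-Copy c (ys⊆ u∈))) u∈

  Before⇒read : ∀ c p {v} → Before c p v → lift c v ∈ₗ take p (read c)
  Before⇒read c p v∈ = lift-∈ c (∈-take⁻ p) (subst (_ ∈ₗ_) (LP.take-map p (read c)) v∈)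

  After⇒read : ∀ c p {v} → After c p v → lift c v ∈ₗ drop p (read c)
  After⇒read c p v∈ = lift-∈ c (∈-drop⁻ p) (subst (_ ∈ₗ_) (LP.drop-map p (read c)) v∈)

  read⇒Before : ∀ c p {u} → u ∈ₗ take p (read c) → Before c p (unlift u)
  read⇒Before c p u∈ = subst (_ ∈ₗ_) (sym (LP.take-map p (read c))) (LMP.∈-map⁺ unlift u∈)

  read⇒After : ∀ c p {u} → u ∈ₗ drop p (read c) → After c p (unlift u)
  read⇒After c p u∈ = subst (_ ∈ₗ_) (sym (LP.drop-map p (read c))) (LMP.∈-map⁺ unlift u∈)

  Before⇒¬After : ∀ c p {v} → Before c p v → ¬ After c p v
  Before⇒¬After c p before after =
    take-drop-disjoint p (read-unique c) (Before⇒read c p before) (After⇒read c p after)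

  -- If the walks for c and c' pass through the same node after reading tuple sets that
  -- are compatible, gluing the prefix for c to the suffix for c' is accepted, and the glued
  -- structure maps to the split of A at any y that crosses the cut and has c y ≢ c' y.
  module Splice (smin : SplitMinimal C A) {c c' : Colouring} {p p' : ℕ} {m m' : Fin (size (H N))}
    (w₁ : Walk (H N) (encode (Copy c)) (src (H N)) m) (labels-w₁ : labels w₁ ≡ take p (read c))
    (w₂ : Walk (H N) (encode (Copy c')) m' (tgt (H N))) (labels-w₂ : labels w₂ ≡ drop p' (read c'))
    (m≡m' : m ≡ m')
    (Before⊆ : ∀ {v} → Before c p v → Before c' p' v) (After⊆ : ∀ {v} → After c p v → After c' p' v)
    {y : Fin n} (c≢c' : c y ≢ c' y) (y-crosses : y ∈ crossing (order c) p) where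

    spliced? : ∀ u → Dec (u ∈ₗ take p (read c) ⊎ u ∈ₗ drop p' (read c'))
    spliced? u = u ∈ₗ? take p (read c) ⊎-dec u ∈ₗ? drop p' (read c')

    Spliced : Str τ N
    rel Spliced R u = does (spliced? (R , u))

    Spliced∈C : C Spliced
    Spliced∈C = proj₁ (def N Spliced)
      (reassign w₁ (λ {x} x∈ → dec-true (spliced? x) (inj₁ (subst (x ∈ₗ_) labels-w₁ x∈)))
       ++ᵂ subst (λ k → Walk (H N) (encode Spliced) k (tgt (H N))) (sym m≡m')
             (reassign w₂ (λ {x} x∈ → dec-true (spliced? x) (inj₂ (subst (x ∈ₗ_) labels-w₂ x∈)))))

    selected? : ∀ {R} (t : Vec (Fin n) (ar τ R)) i → Dec (After c' p' (R , t) × lookup t i ≡ y)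
    selected? {R} t i = (R , t) ∈ₗ? drop p' (order c') ×-dec lookup t i F.≟ y

    early : ∃[ v ] (v ∈ₗ take p (order c) × Occurs y v)
    early = find (proj₁ (∈-subsetOf⁻ (spans? (order c) p p) y-crosses))
    late : ∃[ v ] (v ∈ₗ drop p (order c) × Occurs y v)
    late  = find (proj₂ (∈-subsetOf⁻ (spans? (order c) p p) y-crosses))

    -- split y, moving to the new element its occurrences in tuples read after the cut under c'
    splitAtY : SplitOp A
    splitAtY = record
      { a        = y
      ; T        = T
      ; valid    = λ R t i e → let after , at-y = dec-true⁻ (selected? t i) e in
                     order-tuple c' (∈-drop⁻ p' after) , at-y
      ; nonempty = let (R , t) , after , y∈t = late ; i , at-y = ∈ᵥ⇒lookup y∈t in
                     R , t , i , dec-true (selected? t i) (After⊆ after , at-y)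
      ; proper   = let (R , t) , before , y∈t = early ; i , at-y = ∈ᵥ⇒lookup y∈t in
                     R , t , i , order-tuple c (∈-take⁻ p before) , at-y ,
                     dec-false (selected? t i) (Before⇒¬After c' p' (Before⊆ before) ∘ proj₁) }
      where
      T : (R : Fin (nsym τ)) → Vec (Fin n) (ar τ R) → Fin (ar τ R) → Bool
      T R t i = does (selected? t i)

    Split : Str τ (suc n)
    Split = splitResult splitAtY

    toSplit : Fin N → Fin (suc n)
    toSplit z = if does (z F.≟ place c' y) then zero else suc (base z)

    unsplit-toSplit : ∀ z → unsplit {τ = τ} y (toSplit z) ≡ base z
    unsplit-toSplit z with z F.≟ place c' y
    ... | yes refl = sym (base-place c' y)
    ... | no  _    = refl

    isZero-toSplit : ∀ z → isZero {τ = τ} (toSplit z) ≡ does (z F.≟ place c' y)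
    isZero-toSplit z with z F.≟ place c' y
    ... | yes _ = refl
    ... | no  _ = refl

    placed-tuple : ∀ d {R t} → rel A R t ≡ true →
      (∀ i → SplitOp.T splitAtY R t i ≡ does (place d (lookup t i) F.≟ place c' y)) →
      rel Split R (V.map (toSplit ∘ place d) t) ≡ true
    placed-tuple d {R} {t} e selects = splitResult-tuple splitAtY _ unsplits e λ i →
      trans (selects i) (sym (trans (cong (isZero {τ = τ}) (VP.lookup-map i _ t)) (isZero-toSplit _)))
      where
      unsplits : V.map (unsplit {τ = τ} y) (V.map (toSplit ∘ place d) t) ≡ t
      unsplits = begin
        V.map merge (V.map (toSplit ∘ place d) t) ≡⟨ VP.map-∘ merge (toSplit ∘ place d) t ⟨
        V.map (merge ∘ toSplit ∘ place d) t       ≡⟨ VP.map-cong (λ x → trans (unsplit-toSplit _) (base-place d x)) t ⟩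
        V.map (λ x → x) t                         ≡⟨ VP.map-id t ⟩
        t                                         ∎
        where
        open ≡-Reasoning
        merge : Fin (suc n) → Fin n
        merge = unsplit {τ = τ} y

    read-placed : ∀ d {R u} → (R , u) ≡ lift d (unlift (R , u)) →
      rel Split R (V.map (toSplit ∘ place d) (V.map base u)) ≡ true → rel Split R (V.map toSplit u) ≡ true
    read-placed d {R} {u} lifted = subst (λ u' → rel Split R u' ≡ true)
      (sym (trans (cong (V.map toSplit) (lifted-entries lifted)) (sym (VP.map-∘ toSplit (place d) (V.map base u)))))

    Spliced→Split : Hom Spliced Split
    Spliced→Split = toSplit , λ R u e → [ early-tuple R u , late-tuple R u ]′
      (dec-true⁻ (spliced? (R , u)) e)
      where
      early-tuple : ∀ R u → (R , u) ∈ₗ take p (read c) → rel Split R (V.map toSplit u) ≡ true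
      early-tuple R u u∈ = let A-tuple , lifted = read-Copy c {R , u} (∈-take⁻ p u∈) in
        read-placed c lifted (placed-tuple c A-tuple λ i →
          trans (dec-false (selected? (V.map base u) i)
                           (Before⇒¬After c' p' (Before⊆ (read⇒Before c p u∈)) ∘ proj₁))
                (sym (dec-false (_ F.≟ _) (c≢c' ∘ different-colours ∘ place-injective {c} {c'}))))
        where
        different-colours : ∀ {x} → x ≡ y × c x ≡ c' y → c y ≡ c' y
        different-colours (refl , same) = same
      late-tuple : ∀ R u → (R , u) ∈ₗ drop p' (read c') → rel Split R (V.map toSplit u) ≡ true
      late-tuple R u u∈ = let A-tuple , lifted = read-Copy c' {R , u} (∈-drop⁻ p' u∈) in
        read-placed c' lifted (placed-tuple c' A-tuple λ i → does-⇔
          (mk⇔ (cong (place c') ∘ proj₂) λ eq → read⇒After c' p' u∈ , proj₁ (place-injective {c'} {c'} eq))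
          (selected? (V.map base u) i) (place c' (lookup (V.map base u) i) F.≟ place c' y))

    impossible : ⊥
    impossible = proj₂ smin Split (one splitAtY) (hc Spliced Split Spliced→Split Spliced∈C)

-- Fingerprints of cuts and the pigeonhole argument

module Counting {τ : Sig} {C : Class {τ}} (hc : HomClosed C) {H : Family {τ}} (def : Defines H C)
  (ro : ReadOnce H C) {n : ℕ} {A : Str τ n} (crit : Critical C A) (smin : SplitMinimal C A)
  (j c₀ N₀ : ℕ) (small : ∀ m → N₀ ≤ m → size (H m) ≤ c₀ * m ^ j)
  (L : ℕ) (n≡1+j+L : n ≡ suc (j + L)) where

  opaque
    Vars : List (Var τ n)
    Vars = allVars τ n

    ∈-Vars : ∀ v → v ∈ₗ Vars
    ∈-Vars = ∈-allVars

  K : ℕ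
  K = 2 ^ length Vars * (2 ^ length Vars * 2 ^ n)

  opaque
    M : ℕ
    M = suc (c₀ * n ^ j * K * 2 ^ L + N₀)

    bound<M : c₀ * n ^ j * K * 2 ^ L < M
    bound<M = s≤s (ℕP.m≤m+n _ N₀)

    N₀≤M : N₀ ≤ M
    N₀≤M = ℕP.≤-trans (ℕP.m≤n+m N₀ _) (ℕP.n≤1+n _)

  open ReadOrder hc def ro crit M public

  beforeBits afterBits : Colouring → ℕ → Fin (length Vars) → Bool
  beforeBits c p k = does (L.lookup Vars k ∈ₗ? take p (order c))
  afterBits  c p k = does (L.lookup Vars k ∈ₗ? drop p (order c))

  -- colours of the elements outside X, padded with zero; a crossing wider than j leaves at most L
  coloursOutside : Colouring → Subset n → Fin L → Fin (suc M)
  coloursOutside c X k = maybe (suc ∘ c) zero (lookupMaybe (outsideList X) (toℕ k))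

  outsideColours : Colouring → ℕ → Fin L → Fin (suc M)
  outsideColours c p = coloursOutside c (crossing (order c) p)

  node : Colouring → ℕ → Fin (size (H N))
  node c p = WalkSplit.middle (splitWalkAt (walk c) p)

  fingerprint : Colouring → ℕ → Fin (size (H N) * (K * suc M ^ L))
  fingerprint c p = F.combine (node c p)
    (F.combine (F.combine (bitsToFin (beforeBits c p))
                          (F.combine (bitsToFin (afterBits c p)) (bitsToFin (lookup (crossing (order c) p)))))
               (F.funToFin (outsideColours c p)))

  record SameFingerprint (c : Colouring) (p : ℕ) (c' : Colouring) (p' : ℕ) : Set where
    field
      same-node     : node c p ≡ node c' p'
      same-before   : ∀ k → beforeBits c p k ≡ beforeBits c' p' k
      same-after    : ∀ k → afterBits c p k ≡ afterBits c' p' k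
      same-crossing : crossing (order c) p ≡ crossing (order c') p'
      same-outside  : ∀ k → outsideColours c p k ≡ outsideColours c' p' k

  fingerprint-injective : ∀ {c p c' p'} → fingerprint c p ≡ fingerprint c' p' → SameFingerprint c p c' p'
  fingerprint-injective {c} {p} {c'} {p'} eq with FP.combine-injective (node c p) _ (node c' p') _ eq
  ... | same-node , eq₁ with FP.combine-injective _ _ _ _ eq₁
  ... | eq₂ , same-outside with FP.combine-injective _ _ _ _ eq₂
  ... | same-before , eq₃ with FP.combine-injective _ _ _ _ eq₃
  ... | same-after , same-crossing = record
    { same-node     = same-node
    ; same-before   = bitsToFin-injective _ _ same-before
    ; same-after    = bitsToFin-injective _ _ same-after
    ; same-crossing = begin
        X                    ≡⟨ VP.tabulate∘lookup X ⟨
        tabulate (lookup X)  ≡⟨ VP.tabulate-cong (bitsToFin-injective _ _ same-crossing) ⟩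
        tabulate (lookup X') ≡⟨ VP.tabulate∘lookup X' ⟩
        X'                   ∎
    ; same-outside  = funToFin-injective _ _ same-outside }
    where
    open ≡-Reasoning
    X X' : Subset n
    X  = crossing (order c) p
    X' = crossing (order c') p'

  coloursOutside-at : ∀ c X k {x} → lookupMaybe (outsideList X) (toℕ k) ≡ just x →
                      coloursOutside c X k ≡ suc (c x)
  coloursOutside-at c X k = cong (maybe (suc ∘ c) zero)

  outside-determined : ∀ {c c' X} → (∀ k → coloursOutside c X k ≡ coloursOutside c' X k) →
                       length (outsideList X) ≤ L → ∀ {x} → lookup X x ≡ false → c x ≡ c' x
  outside-determined {c} {c'} {X} same short {x} x∉ with lookupMaybe-∈ (∈-outsideList X x∉)
  ... | k , k<len , at-k = FP.suc-injective (begin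
    suc (c x)                 ≡⟨ coloursOutside-at c X index at-index ⟨
    coloursOutside c X index  ≡⟨ same index ⟩
    coloursOutside c' X index ≡⟨ coloursOutside-at c' X index at-index ⟩
    suc (c' x)                ∎)
    where
    open ≡-Reasoning
    index : Fin L
    index = F.fromℕ< (ℕP.<-≤-trans k<len short)
    at-index : lookupMaybe (outsideList X) (toℕ index) ≡ just x
    at-index = trans (cong (lookupMaybe (outsideList X)) (FP.toℕ-fromℕ< _)) at-k

  short-outside : ∀ X → j < ∣ X ∣ → length (outsideList X) ≤ L
  short-outside X wide = ℕP.+-cancelʳ-≤ ∣ X ∣ _ _ (begin
    length (outsideList X) + ∣ X ∣ ≡⟨ trans (length-outsideList X) n≡1+j+L ⟩
    suc j + L                      ≤⟨ ℕP.+-monoˡ-≤ L wide ⟩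
    ∣ X ∣ + L                      ≡⟨ ℕP.+-comm ∣ X ∣ L ⟩
    L + ∣ X ∣                      ∎)
    where open ℕP.≤-Reasoning

  -- Two different colourings cannot have wide cuts with the same fingerprint: at an element
  -- where they differ, either the crossing contains it and splicing contradicts split-minimality,
  -- or it lies outside the crossing and the recorded colours coincide.
  collision-impossible : ∀ {c c' p p'} → ¬ (∀ x → c x ≡ c' x) → j < ∣ crossing (order c) p ∣ →
                         SameFingerprint c p c' p' → ⊥
  collision-impossible {c} {c'} {p} {p'} c≢c' wide same with FP.¬∀⟶∃¬ n _ (λ x → c x F.≟ c' x) c≢c'
  ... | y , cy≢c'y with lookup (crossing (order c) p) y in y∈?
  ... | true  = Splice.impossible smin (WalkSplit.prefix split) (WalkSplit.labels-prefix split)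
                  (WalkSplit.suffix split') (WalkSplit.labels-suffix split') same-node
                  (agree-on-enumeration (_∈ₗ? take p (order c)) (_∈ₗ? take p' (order c')) Vars ∈-Vars same-before)
                  (agree-on-enumeration (_∈ₗ? drop p (order c)) (_∈ₗ? drop p' (order c')) Vars ∈-Vars same-after)
                  cy≢c'y (VP.lookup⇒[]= y _ y∈?)
    where
    open SameFingerprint same
    split  : WalkSplit (walk c) p
    split  = splitWalkAt (walk c) p
    split' : WalkSplit (walk c') p'
    split' = splitWalkAt (walk c') p'
  ... | false = cy≢c'y (outside-determined {X = X} same-outside′ (short-outside X wide) y∈?)
    where
    open SameFingerprint same
    X : Subset n
    X = crossing (order c) p
    same-outside′ : ∀ k → coloursOutside c X k ≡ coloursOutside c' X k
    same-outside′ k = trans (same-outside k) (cong (λ X → coloursOutside c' X k) (sym same-crossing))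

  narrow? : ∀ c → Dec (CutwidthAtMost j (order c))
  narrow? c = FP.all? (λ q → ∣ crossing (order c) (toℕ q) ∣ ≤? j)

  wideCut : ∀ c → ¬ CutwidthAtMost j (order c) → ∃[ q ] j < ∣ crossing (order c) q ∣
  wideCut c not-narrow =
    let q , q-wide = FP.¬∀⟶∃¬ _ _ (λ q → ∣ crossing (order c) (toℕ q) ∣ ≤? j) not-narrow in
    toℕ q , ℕP.≰⇒> q-wide

  -- Colourings are indexed by Fin (M ^ n); there are more of them than fingerprints.
  all-wide-impossible : (∀ i → ¬ CutwidthAtMost j (order (F.finToFun {M} {n} i))) → ⊥
  all-wide-impossible all-wide = from-collision (FP.pigeonhole fewer (λ i → fingerprint (F.finToFun i) (cut i)))
    where
    cut : Fin (M ^ n) → ℕ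
    cut i = proj₁ (wideCut (F.finToFun i) (all-wide i))

    wide : ∀ i → j < ∣ crossing (order (F.finToFun i)) (cut i) ∣
    wide i = proj₂ (wideCut (F.finToFun i) (all-wide i))

    fewer : size (H N) * (K * suc M ^ L) < M ^ n
    fewer = subst (λ e → size (H N) * (K * suc M ^ L) < M ^ e) (sym n≡1+j+L)
      (s*[K*[1+M]^L]<M^[1+j+L] c₀ n j K L M (size (H N)) (small N N₀≤N) bound<M)
      where
      N₀≤N : N₀ ≤ N
      N₀≤N = ℕP.≤-trans N₀≤M (subst (λ n → M ≤ n * M) (sym n≡1+j+L) (ℕP.m≤m+n M _))

    from-collision : (∃₂ λ i i' → i F.< i' × fingerprint (F.finToFun i) (cut i)
                                          ≡ fingerprint (F.finToFun i') (cut i')) → ⊥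
    from-collision (i , i' , i<i' , collide) = collision-impossible
      (λ same → FP.<⇒≢ i<i' (finToFun-injective i i' same)) (wide i) (fingerprint-injective collide)

  narrowColouring : ∃[ c ] CutwidthAtMost j (order c)
  narrowColouring = pick (FP.any? (narrow? ∘ F.finToFun))
    where
    pick : Dec (∃[ i ] CutwidthAtMost j (order (F.finToFun {M} {n} i))) → ∃[ c ] CutwidthAtMost j (order c)
    pick (yes (i , narrow)) = F.finToFun i , narrow
    pick (no  none)         = ⊥-elim (all-wide-impossible (λ i narrow → none (i , narrow)))

theorem9 : (τ : Sig) (C : Class {τ}) → HomClosed C → (j : ℕ) →
           (H : Family {τ}) → Defines H C → ReadOnce H C → SizeO H j →
           ∀ n (A : Str τ n) → Critical C A → SplitMinimal C A →
           PathDecomp A j (maxArity τ + j)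
theorem9 τ C hc j H def ro (c₀ , N₀ , small) n A crit smin with n ≤? j
... | yes n≤j = singleBagDecomp A j _ (ℕP.≤-trans n≤j (ℕP.m≤n+m j (maxArity τ)))
... | no  n≰j = decomposition narrowColouring
  where
  open Counting hc def ro crit smin j c₀ N₀ small (n ∸ suc j) (sym (ℕP.m+[n∸m]≡n (ℕP.≰⇒> n≰j)))
  decomposition : ∃[ c ] CutwidthAtMost j (order c) → PathDecomp A j (maxArity τ + j)
  decomposition (c , narrow) = pathDecomp-fromCutwidth A (order c) (order-covers c) narrow
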